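{- Let $a$ be a positive integer, put $s=r(a)$ and $t=m(a)$, let $q$ be the largest integer such that $2q<(t+1)^2$, and let $b(a)=\min(q,2^s)$. Then $b(a)$ is the largest positive integer $k$ such that $r(k)=s$ and $m(k)=t$, and for all positive integers $n_1,n_2$ with $a\le n_1\le n_2\le b(a)$ we have $$x(a)\le x(n_1)=z(n_1)-(r(a)+1)m(a)\le x(n_2)\le x(b(a)).$$
   Context: For a positive integer $n$: $z(n)$ denotes the largest integer such that $3z(n)<2n$; $m(n)$ denotes the largest integer such that $m(n)^2\le 2n$; $r(n)$ denotes the least non-negative integer such that $n\le 2^{r(n)}$; and $x(n)=z(n)-(r(n)+1)m(n)$. -}

module Defs where

open import Data.Nat using (ℕ; zero; suc; _+_; _*_; _^_; _<_; _≤_; _<?_; _≤?_; _⊓_)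
open import Data.Bool using (Bool; if_then_else_)
open import Data.Integer as ℤ using (ℤ; +_)
open import Relation.Nullary.Decidable using (⌊_⌋)

-- Literal bounded searches.
-- greatestUpTo P N : the largest k ≤ N with P k (0 if none).
greatestUpTo : (ℕ → Bool) → ℕ → ℕ
greatestUpTo P zero = zero
greatestUpTo P (suc N) = if P (suc N) then suc N else greatestUpTo P N

-- leastFrom P i fuel : the least k ≥ i with P k among i .. i + fuel (i + fuel if none).
leastFrom : (ℕ → Bool) → ℕ → ℕ → ℕ
leastFrom P i zero = i
leastFrom P i (suc fuel) = if P i then i else leastFrom P (suc i) fuel

-- z(n): largest integer with 3 z < 2 n   (for n ≥ 1 it lies in [0, n], and z ≥ 0)
z : ℕ → ℕ
z n = greatestUpTo (λ k → ⌊ 3 * k <? 2 * n ⌋) n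

-- m(n): largest integer with m² ≤ 2 n  (it lies in [0, 2n])
m : ℕ → ℕ
m n = greatestUpTo (λ k → ⌊ k * k ≤? 2 * n ⌋) (2 * n)

-- r(n): least non-negative integer with n ≤ 2^r  (it lies in [0, n])
r : ℕ → ℕ
r n = leastFrom (λ k → ⌊ n ≤? 2 ^ k ⌋) 0 n

x : ℕ → ℤ
x n = + z n ℤ.- + ((r n + 1) * m n)

-- q(t): largest integer with 2 q < (t+1)²  (it lies in [0, (t+1)²])
q : ℕ → ℕ
q t = greatestUpTo (λ k → ⌊ 2 * k <? (t + 1) * (t + 1) ⌋) ((t + 1) * (t + 1))

b : ℕ → ℕ
b a = q (m a) ⊓ (2 ^ r a)

module Submission where

open import Defs
open import Data.Nat using (ℕ; _+_; _*_; _≤_)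
open import Data.Integer as ℤ using (+_)
open import Data.Product using (_×_)
open import Relation.Binary.PropositionalEquality using (_≡_)

open import Data.Nat using (zero; suc; _<_; _^_; _⊓_; z≤n; s≤s; z<s; _≤?_; _<?_)
open import Data.Nat.Properties
open import Data.Bool using (Bool; true; false)
open import Data.Empty using (⊥-elim)
open import Data.Sum using (inj₁; inj₂)
open import Data.Product using (_,_)
open import Function.Bundles using (_⇔_; mk⇔; Equivalence)
open import Relation.Nullary using (Dec; yes; no)
open import Relation.Nullary.Decidable using (⌊_⌋)
open import Relation.Unary using (Pred; Decidable)
open import Level using (0ℓ)
open import Relation.Binary.PropositionalEquality using (refl; sym; cong₂; subst; subst₂)
import Data.Integer.Properties as ℤ

-- Both r and m are lower adjoints: r k ≤ s ⇔ k ≤ 2^s, and m k ≤ t ⇔ 2k < (t+1)² ⇔ k ≤ q t.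
-- Hence k ≤ b(a) ⇔ r k ≤ r a ∧ m k ≤ m a; as r and m are monotone, they are constant on
-- [a, b(a)], where x is therefore z minus a constant, and z is monotone.

open Equivalence using (to; from)

greatestUpTo-≤ : ∀ (P : ℕ → Bool) N → greatestUpTo P N ≤ N
greatestUpTo-≤ P zero = z≤n
greatestUpTo-≤ P (suc N) with P (suc N)
... | true  = ≤-refl
... | false = m≤n⇒m≤1+n (greatestUpTo-≤ P N)

module _ {P : Pred ℕ 0ℓ} (P? : Decidable P) where

  greatestUpTo-satisfies : ∀ N → P 0 → P (greatestUpTo (λ k → ⌊ P? k ⌋) N)
  greatestUpTo-satisfies zero    P0 = P0
  greatestUpTo-satisfies (suc N) P0 with P? (suc N)
  ... | yes PN = PN
  ... | no  _  = greatestUpTo-satisfies N P0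

  ≤-greatestUpTo : ∀ N {k} → P k → k ≤ N → k ≤ greatestUpTo (λ k → ⌊ P? k ⌋) N
  ≤-greatestUpTo zero    Pk k≤N = k≤N
  ≤-greatestUpTo (suc N) Pk k≤N with P? (suc N) | m≤n⇒m<n∨m≡n k≤N
  ... | yes _   | _         = k≤N
  ... | no  _   | inj₁ k<   = ≤-greatestUpTo N Pk (≤-pred k<)
  ... | no  ¬PN | inj₂ refl = ⊥-elim (¬PN Pk)

  leastFrom-≤ : ∀ i fuel {k} → P k → i ≤ k → leastFrom (λ k → ⌊ P? k ⌋) i fuel ≤ k
  leastFrom-≤ i zero       Pk i≤k = i≤k
  leastFrom-≤ i (suc fuel) Pk i≤k with P? i | m≤n⇒m<n∨m≡n i≤k
  ... | yes _   | _         = i≤k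
  ... | no  _   | inj₁ i<k  = leastFrom-≤ (suc i) fuel Pk i<k
  ... | no  ¬Pi | inj₂ refl = ⊥-elim (¬Pi Pk)

  leastFrom-satisfies : ∀ i fuel {k} → P k → i ≤ k → k ≤ i + fuel →
    P (leastFrom (λ k → ⌊ P? k ⌋) i fuel)
  leastFrom-satisfies i zero {k} Pk i≤k k≤i+0 =
    subst P (≤-antisym (subst (k ≤_) (+-identityʳ i) k≤i+0) i≤k) Pk
  leastFrom-satisfies i (suc fuel) {k} Pk i≤k k≤ with P? i | m≤n⇒m<n∨m≡n i≤k
  ... | yes Pi  | _         = Pi
  ... | no  _   | inj₁ i<k  = leastFrom-satisfies (suc i) fuel Pk i<k (subst (k ≤_) (+-suc i fuel) k≤)
  ... | no  ¬Pi | inj₂ refl = ⊥-elim (¬Pi Pk)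

n≤2^n : ∀ n → n ≤ 2 ^ n
n≤2^n zero    = z≤n
n≤2^n (suc n) = +-mono-≤ (m^n>0 2 n) (≤-trans (n≤2^n n) (m≤m+n (2 ^ n) 0))

n≤n*n : ∀ n → n ≤ n * n
n≤n*n zero      = z≤n
n≤n*n n@(suc _) = m≤m*n n n

m*m<n*n⇒m<n : ∀ {m n} → m * m < n * n → m < n
m*m<n*n⇒m<n {m} {n} m²<n² with n ≤? m
... | yes n≤m = ⊥-elim (<⇒≱ m²<n² (*-mono-≤ n≤m n≤m))
... | no  n≰m = ≰⇒> n≰m

[1+n]² : ∀ n → (n + 1) * (n + 1) ≡ suc n * suc n
[1+n]² n = cong₂ _*_ (+-comm n 1) (+-comm n 1)

≤2^r : ∀ n → n ≤ 2 ^ r n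
≤2^r n = leastFrom-satisfies (λ k → n ≤? 2 ^ k) 0 n (n≤2^n n) z≤n ≤-refl

r≤⇔ : ∀ n {k} → r n ≤ k ⇔ n ≤ 2 ^ k
r≤⇔ n {k} = mk⇔
  (λ r≤k → ≤-trans (≤2^r n) (^-monoʳ-≤ 2 r≤k))
  (λ n≤2^k → leastFrom-≤ (λ j → n ≤? 2 ^ j) 0 n n≤2^k z≤n)

r-mono : ∀ {n n′} → n ≤ n′ → r n ≤ r n′
r-mono {n} {n′} n≤n′ = from (r≤⇔ n) (≤-trans n≤n′ (≤2^r n′))

m²≤2n : ∀ n → m n * m n ≤ 2 * n
m²≤2n n = greatestUpTo-satisfies (λ k → k * k ≤? 2 * n) (2 * n) z≤n

≤m : ∀ n {k} → k * k ≤ 2 * n → k ≤ m n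
≤m n {k} k²≤2n = ≤-greatestUpTo (λ j → j * j ≤? 2 * n) (2 * n) k²≤2n (≤-trans (n≤n*n k) k²≤2n)

2n<[1+m]² : ∀ n → 2 * n < suc (m n) * suc (m n)
2n<[1+m]² n = ≰⇒> λ [1+m]²≤2n → 1+n≰n (≤m n [1+m]²≤2n)

m≤⇔ : ∀ n {t} → m n ≤ t ⇔ 2 * n < (t + 1) * (t + 1)
m≤⇔ n {t} = mk⇔
  (λ m≤t → subst (2 * n <_) (sym ([1+n]² t)) (<-≤-trans (2n<[1+m]² n) (*-mono-≤ (s≤s m≤t) (s≤s m≤t))))
  (λ 2n<[t+1]² → ≤-pred (m*m<n*n⇒m<n (≤-<-trans (m²≤2n n) (subst (2 * n <_) ([1+n]² t) 2n<[t+1]²))))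

m-mono : ∀ {n n′} → n ≤ n′ → m n ≤ m n′
m-mono {n} {n′} n≤n′ = ≤m n′ (≤-trans (m²≤2n n) (*-monoʳ-≤ 2 n≤n′))

≤q⇔ : ∀ t {k} → k ≤ q t ⇔ 2 * k < (t + 1) * (t + 1)
≤q⇔ t {k} = mk⇔
  (λ k≤q → ≤-<-trans (*-monoʳ-≤ 2 k≤q) 2q<[t+1]²)
  (λ 2k<[t+1]² → ≤-greatestUpTo P? ((t + 1) * (t + 1)) 2k<[t+1]² (≤-trans (m≤n*m k 2) (<⇒≤ 2k<[t+1]²)))
  where
  P? : ∀ j → Dec (2 * j < (t + 1) * (t + 1))
  P? j = 2 * j <? (t + 1) * (t + 1)
  2q<[t+1]² : 2 * q t < (t + 1) * (t + 1)
  2q<[t+1]² = greatestUpTo-satisfies P? ((t + 1) * (t + 1))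
    (subst (0 <_) (sym ([1+n]² t)) z<s)

≤b⇔ : ∀ a {k} → k ≤ b a ⇔ (r k ≤ r a × m k ≤ m a)
≤b⇔ a {k} = mk⇔
  (λ k≤b → from (r≤⇔ k) (≤-trans k≤b (m⊓n≤n _ _)) , from (m≤⇔ k) (to (≤q⇔ (m a)) (≤-trans k≤b (m⊓n≤m _ _))))
  (λ (r≤ , m≤) → ⊓-glb (from (≤q⇔ (m a)) (to (m≤⇔ k) m≤)) (to (r≤⇔ k) r≤))

≤b : ∀ a → a ≤ b a
≤b a = from (≤b⇔ a) (≤-refl , ≤-refl)

r-m-constant : ∀ {a k} → a ≤ k → k ≤ b a → r k ≡ r a × m k ≡ m a
r-m-constant {a} a≤k k≤b = let (r≤ , m≤) = to (≤b⇔ a) k≤b in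
  ≤-antisym r≤ (r-mono a≤k) , ≤-antisym m≤ (m-mono a≤k)

z-mono : ∀ {n n′} → n ≤ n′ → z n ≤ z n′
z-mono {zero}             _    = z≤n
z-mono {n@(suc _)} {n′} n≤n′ =
  ≤-greatestUpTo (λ k → 3 * k <? 2 * n′) n′ (<-≤-trans 3z<2n (*-monoʳ-≤ 2 n≤n′))
    (≤-trans (greatestUpTo-≤ _ n) n≤n′)
  where
  3z<2n : 3 * z n < 2 * n
  3z<2n = greatestUpTo-satisfies (λ k → 3 * k <? 2 * n) n z<s

x-on-[a,b] : ∀ {a} n → a ≤ n → n ≤ b a → x n ≡ + z n ℤ.- + ((r a + 1) * m a)
x-on-[a,b] n a≤n n≤b = let (r≡ , m≡) = r-m-constant a≤n n≤b in
  cong₂ (λ s t → + z n ℤ.- + ((s + 1) * t)) r≡ m≡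

x-mono-on-[a,b] : ∀ {a n n′} → a ≤ n → n ≤ n′ → n′ ≤ b a → x n ℤ.≤ x n′
x-mono-on-[a,b] {a} {n} {n′} a≤n n≤n′ n′≤b =
  subst₂ ℤ._≤_ (sym (x-on-[a,b] n a≤n (≤-trans n≤n′ n′≤b))) (sym (x-on-[a,b] n′ (≤-trans a≤n n≤n′) n′≤b))
    (ℤ.+-monoˡ-≤ (ℤ.- + ((r a + 1) * m a)) (ℤ.+≤+ (z-mono {n} n≤n′)))

lemma3 : (a : ℕ) → 1 ≤ a →
    ((1 ≤ b a × r (b a) ≡ r a × m (b a) ≡ m a)
      × ((k : ℕ) → 1 ≤ k → r k ≡ r a → m k ≡ m a → k ≤ b a))
    × ((n₁ n₂ : ℕ) → 1 ≤ n₁ → 1 ≤ n₂ → a ≤ n₁ → n₁ ≤ n₂ → n₂ ≤ b a →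
        (x a ℤ.≤ x n₁)
        × (x n₁ ≡ + z n₁ ℤ.- + ((r a + 1) * m a))
        × (x n₁ ℤ.≤ x n₂)
        × (x n₂ ℤ.≤ x (b a)))
lemma3 a 1≤a =
  ((≤-trans 1≤a (≤b a) , r-m-constant (≤b a) ≤-refl)
  , λ _ _ r≡ m≡ → from (≤b⇔ a) (≤-reflexive r≡ , ≤-reflexive m≡))
  , λ n₁ n₂ _ _ a≤n₁ n₁≤n₂ n₂≤b →
      x-mono-on-[a,b] ≤-refl a≤n₁ (≤-trans n₁≤n₂ n₂≤b)
    , x-on-[a,b] n₁ a≤n₁ (≤-trans n₁≤n₂ n₂≤b)
    , x-mono-on-[a,b] a≤n₁ n₁≤n₂ n₂≤b
    , x-mono-on-[a,b] (≤-trans a≤n₁ n₁≤n₂) n₂≤b ≤-refl
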